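{- Let $A\leq B\leq C$ be groups and $n\ge 1$ an integer, and suppose that $C_C^k(A)=C_C^k(C)$ for all $k<n$. Then $C_B^j(A)=C_C^j(A)\cap B$ for all $1\le j\leq n$.
   Context: For a subgroup $P$ of a group $G$, the iterated centralizers of $P$ in $G$ are defined by $C_G^0(P)=1$ and, for $n\geq 1$, $C_G^n(P)=\{x\in\bigcap_{k<n}N_G(C_G^k(P)) : [x,P]\subseteq C_G^{n-1}(P)\}$, where $[x,P]$ denotes the set of commutators $[x,p]=x^{ -1}p^{ -1}xp$, $p\in P$. Note $C_G^n(G)=Z_n(G)$ is the $n$th term of the upper central series. -}

module Defs where

open import Level using (Level; _⊔_; Lift)
open import Data.Nat using (ℕ; zero; suc)
open import Data.Product using (_×_)
open import Data.Unit.Polymorphic using (⊤)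
open import Relation.Unary using (Pred; _∈_)
open import Algebra.Bundles using (Group)

module GroupDefs {c ℓ : Level} (G : Group c ℓ) where
  open Group G

  record IsSubgroup (S : Pred Carrier ℓ) : Set (c ⊔ ℓ) where
    field
      resp      : ∀ {x y} → x ≈ y → S x → S y
      ε∈        : S ε
      ∙-closed  : ∀ {x y} → S x → S y → S (x ∙ y)
      ⁻¹-closed : ∀ {x} → S x → S (x ⁻¹)

  Whole : Pred Carrier ℓ
  Whole _ = ⊤

  [_,_] : Carrier → Carrier → Carrier
  [ x , p ] = x ⁻¹ ∙ p ⁻¹ ∙ x ∙ p

  Normalizes : Pred Carrier (c ⊔ ℓ) → Carrier → Set (c ⊔ ℓ)
  Normalizes S x = ∀ y → (S y → S (x ⁻¹ ∙ y ∙ x)) × (S (x ⁻¹ ∙ y ∙ x) → S y)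

  -- Iterated centralizers C_H^n(P), computed inside the subgroup H of G:
  --   C_H^0(P) = 1,
  --   C_H^n(P) = { x ∈ H ∩ ⋂_{k<n} N_H(C_H^k(P)) : [x,p] ∈ C_H^{n-1}(P) ∀ p ∈ P }.
  module _ (H P : Pred Carrier ℓ) where
    mutual
      Cent : ℕ → Pred Carrier (c ⊔ ℓ)
      Cent zero    x = Lift c (x ≈ ε)
      Cent (suc n) x =
        H x × NormAll n x × (∀ p → P p → Cent n [ x , p ])

      NormAll : ℕ → Carrier → Set (c ⊔ ℓ)
      NormAll zero    x = Normalizes (Cent zero) x
      NormAll (suc n) x = NormAll n x × Normalizes (Cent (suc n)) x

module Submission where

-- Write D k = C_C^k(A), E k = C_B^k(A) and Z k = C_C^k(C) = Z_k(C).
-- The proof has three ingredients.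
--  * Conjugation by g is an automorphism; in particular it commutes with
--    commutators, and the sets C_H^k(P) respect the setoid equality.
--  * Every Z k is normal in C (induction on k: conjugating an element
--    whose commutators lie in Z k gives one whose commutators lie in Z k).
--  * Restriction: if D k is normal in C for every k < n, then
--    E k = D k ∩ B for every k ≤ n.  By strong induction on k: an element
--    of D (k+1) ∩ B normalizes each D i ∩ B (i ≤ k), which equals E i by
--    the induction hypothesis, and its commutators with A lie in D k ∩ B.
-- The theorem follows: the hypothesis D k = Z k (k < n) makes D k normal.

open import Defs
open import Level using (Level; _⊔_; lift)
open import Data.Nat using (ℕ; _≤_; _<_; zero; suc; z≤n; s≤s)
open import Data.Nat.Properties using (≤-refl; ≤-trans; ≤-<-trans; ≤-pred; m≤n⇒m≤1+n; m≤n⇒m<n∨m≡n)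
open import Data.Nat.Induction using (<-rec)
open import Data.Product using (_,_; proj₁; proj₂)
open import Data.Sum using (inj₁; inj₂)
open import Data.Unit.Polymorphic using (tt)
open import Function using (_∘_)
open import Relation.Binary.PropositionalEquality using (refl)
open import Relation.Unary using (Pred; _⊆_; _∩_; _≐_)
open import Algebra.Bundles using (Group)
import Algebra.Properties.Group as GroupProperties
import Relation.Binary.Reasoning.Setoid as SetoidReasoning

module Conjugation {c ℓ : Level} (G : Group c ℓ) where
  open Group G
  open GroupDefs G using ([_,_])
  open GroupProperties G using (⁻¹-anti-homo-∙; ⁻¹-involutive)
  open SetoidReasoning setoid

  conj : Carrier → Carrier → Carrier
  conj g a = g ⁻¹ ∙ a ∙ g

  conj-congˡ : ∀ {g h} a → g ≈ h → conj g a ≈ conj h a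
  conj-congˡ a g≈h = ∙-cong (∙-congʳ (⁻¹-cong g≈h)) g≈h

  conj-congʳ : ∀ g {a b} → a ≈ b → conj g a ≈ conj g b
  conj-congʳ g a≈b = ∙-congʳ (∙-congˡ a≈b)

  commutator-congˡ : ∀ {x y} p → x ≈ y → [ x , p ] ≈ [ y , p ]
  commutator-congˡ p x≈y = ∙-congʳ (∙-cong (∙-congʳ (⁻¹-cong x≈y)) x≈y)

  commutator-congʳ : ∀ x {p q} → p ≈ q → [ x , p ] ≈ [ x , q ]
  commutator-congʳ x p≈q = ∙-cong (∙-congʳ (∙-congˡ (⁻¹-cong p≈q))) p≈q

  cancel-around : ∀ a b y c d → a ∙ b ≈ ε → c ∙ d ≈ ε → a ∙ (b ∙ y ∙ c) ∙ d ≈ y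
  cancel-around a b y c d ab≈ε cd≈ε = begin
    a ∙ (b ∙ y ∙ c) ∙ d   ≈⟨ assoc _ _ _ ⟩
    a ∙ (b ∙ y ∙ c ∙ d)   ≈⟨ ∙-congˡ (assoc _ _ _) ⟩
    a ∙ (b ∙ y ∙ (c ∙ d)) ≈⟨ ∙-congˡ (∙-congˡ cd≈ε) ⟩
    a ∙ (b ∙ y ∙ ε)       ≈⟨ ∙-congˡ (identityʳ _) ⟩
    a ∙ (b ∙ y)           ≈⟨ assoc _ _ _ ⟨
    a ∙ b ∙ y             ≈⟨ ∙-congʳ ab≈ε ⟩
    ε ∙ y                 ≈⟨ identityˡ y ⟩
    y                     ∎

  conj-cancelˡ : ∀ g y → conj (g ⁻¹) (conj g y) ≈ y
  conj-cancelˡ g y = cancel-around (g ⁻¹ ⁻¹) (g ⁻¹) y g (g ⁻¹) (inverseˡ (g ⁻¹)) (inverseʳ g)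

  conj-cancelʳ : ∀ g y → conj g (conj (g ⁻¹) y) ≈ y
  conj-cancelʳ g y = cancel-around (g ⁻¹) (g ⁻¹ ⁻¹) y (g ⁻¹) g (inverseʳ (g ⁻¹)) (inverseˡ g)

  conj-ε : ∀ g → conj g ε ≈ ε
  conj-ε g = trans (∙-congʳ (identityʳ (g ⁻¹))) (inverseˡ g)

  conj-∙ : ∀ g a b → conj g (a ∙ b) ≈ conj g a ∙ conj g b
  conj-∙ g a b = begin
    g ⁻¹ ∙ (a ∙ b) ∙ g                 ≈⟨ ∙-congʳ (assoc _ _ _) ⟨
    g ⁻¹ ∙ a ∙ b ∙ g                   ≈⟨ ∙-congʳ (∙-congˡ (identityˡ b)) ⟨
    g ⁻¹ ∙ a ∙ (ε ∙ b) ∙ g             ≈⟨ ∙-congʳ (∙-congˡ (∙-congʳ (inverseʳ g))) ⟨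
    g ⁻¹ ∙ a ∙ (g ∙ g ⁻¹ ∙ b) ∙ g      ≈⟨ ∙-congʳ (∙-congˡ (assoc _ _ _)) ⟩
    g ⁻¹ ∙ a ∙ (g ∙ (g ⁻¹ ∙ b)) ∙ g    ≈⟨ ∙-congʳ (assoc _ _ _) ⟨
    g ⁻¹ ∙ a ∙ g ∙ (g ⁻¹ ∙ b) ∙ g      ≈⟨ assoc _ _ _ ⟩
    g ⁻¹ ∙ a ∙ g ∙ (g ⁻¹ ∙ b ∙ g)      ∎

  conj-⁻¹ : ∀ g a → conj g (a ⁻¹) ≈ conj g a ⁻¹
  conj-⁻¹ g a = begin
    g ⁻¹ ∙ a ⁻¹ ∙ g          ≈⟨ assoc _ _ _ ⟩
    g ⁻¹ ∙ (a ⁻¹ ∙ g)        ≈⟨ ∙-congˡ (∙-congˡ (⁻¹-involutive g)) ⟨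
    g ⁻¹ ∙ (a ⁻¹ ∙ g ⁻¹ ⁻¹)  ≈⟨ ∙-congˡ (⁻¹-anti-homo-∙ _ _) ⟨
    g ⁻¹ ∙ (g ⁻¹ ∙ a) ⁻¹     ≈⟨ ⁻¹-anti-homo-∙ _ _ ⟨
    (g ⁻¹ ∙ a ∙ g) ⁻¹        ∎

  conj-commutator : ∀ g x q → conj g [ x , q ] ≈ [ conj g x , conj g q ]
  conj-commutator g x q = begin
    conj g (x ⁻¹ ∙ q ⁻¹ ∙ x ∙ q)                                 ≈⟨ conj-∙ g _ _ ⟩
    conj g (x ⁻¹ ∙ q ⁻¹ ∙ x) ∙ conj g q                          ≈⟨ ∙-congʳ (conj-∙ g _ _) ⟩
    conj g (x ⁻¹ ∙ q ⁻¹) ∙ conj g x ∙ conj g q                   ≈⟨ ∙-congʳ (∙-congʳ (conj-∙ g _ _)) ⟩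
    conj g (x ⁻¹) ∙ conj g (q ⁻¹) ∙ conj g x ∙ conj g q
      ≈⟨ ∙-congʳ (∙-congʳ (∙-cong (conj-⁻¹ g x) (conj-⁻¹ g q))) ⟩
    conj g x ⁻¹ ∙ conj g q ⁻¹ ∙ conj g x ∙ conj g q              ∎

module Centralizers {c ℓ : Level} (G : Group c ℓ) where
  open Group G
  open GroupDefs G using (IsSubgroup; Normalizes; NormAll; Cent)
  open Conjugation G

  Respects≈ : ∀ {a} → Pred Carrier a → Set (c ⊔ ℓ ⊔ a)
  Respects≈ S = ∀ {x y} → x ≈ y → S x → S y

  Normalizes-resp : ∀ {S} → Respects≈ S → Respects≈ (Normalizes S)
  Normalizes-resp S-resp x≈y N z =
    (λ s → S-resp (conj-congˡ z x≈y) (proj₁ (N z) s)) ,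
    (λ s → proj₂ (N z) (S-resp (sym (conj-congˡ z x≈y)) s))

  Normalizes-≐ : ∀ {S T x} → S ≐ T → Normalizes T x → Normalizes S x
  Normalizes-≐ (S⊆T , T⊆S) N y = T⊆S ∘ proj₁ (N y) ∘ S⊆T , T⊆S ∘ proj₂ (N y) ∘ S⊆T

  Normalizes-∩ : ∀ {S : Pred Carrier (c ⊔ ℓ)} {B : Pred Carrier ℓ} {x} →
                 IsSubgroup B → Normalizes S x → B x → Normalizes (S ∩ B) x
  Normalizes-∩ {B = B} {x} B-sub N x∈B y =
    (λ (s , y∈B) → proj₁ (N y) s , conj-closed x∈B y∈B) ,
    (λ (s , y∈B) → proj₂ (N y) s ,
                   resp (conj-cancelˡ x y) (conj-closed (⁻¹-closed x∈B) y∈B))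
    where
    open IsSubgroup B-sub
    conj-closed : ∀ {g a} → B g → B a → B (conj g a)
    conj-closed g∈B a∈B = ∙-closed (∙-closed (⁻¹-closed g∈B) a∈B) g∈B

  module _ {H P : Pred Carrier ℓ} where
    NormAll-at : ∀ k {i x} → i ≤ k → NormAll H P k x → Normalizes (Cent H P i) x
    NormAll-at zero    z≤n na = na
    NormAll-at (suc k) i≤1+k (na , n) with m≤n⇒m<n∨m≡n i≤1+k
    ... | inj₁ i<1+k = NormAll-at k (≤-pred i<1+k) na
    ... | inj₂ refl  = n

    NormAll-intro : ∀ k {x} → (∀ {i} → i ≤ k → Normalizes (Cent H P i) x) → NormAll H P k x
    NormAll-intro zero    N = N z≤n
    NormAll-intro (suc k) N = NormAll-intro k (N ∘ m≤n⇒m≤1+n) , N ≤-refl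

    module _ (H-resp : Respects≈ H) where
      mutual
        Cent-resp : ∀ k → Respects≈ (Cent H P k)
        Cent-resp zero    x≈y (lift x≈ε) = lift (trans (sym x≈y) x≈ε)
        Cent-resp (suc k) x≈y (x∈H , na , comm) =
          H-resp x≈y x∈H , NormAll-resp k x≈y na ,
          λ p p∈P → Cent-resp k (commutator-congˡ p x≈y) (comm p p∈P)

        NormAll-resp : ∀ k → Respects≈ (NormAll H P k)
        NormAll-resp zero    = Normalizes-resp (Cent-resp zero)
        NormAll-resp (suc k) x≈y (na , n) =
          NormAll-resp k x≈y na , Normalizes-resp (Cent-resp (suc k)) x≈y n

module UpperCentralSeries {c ℓ : Level} (G : Group c ℓ) where
  open Group G
  open GroupDefs G using (Whole; Normalizes; NormAll; Cent; [_,_])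
  open Conjugation G
  open Centralizers G

  Z : ℕ → Pred Carrier (c ⊔ ℓ)
  Z = Cent Whole Whole

  Z-resp : ∀ k → Respects≈ (Z k)
  Z-resp = Cent-resp (λ _ _ → tt)

  Z₀-normal : ∀ g → Normalizes (Z zero) g
  Z₀-normal g y =
    (λ (lift y≈ε) → lift (trans (conj-congʳ g y≈ε) (conj-ε g))) ,
    (λ (lift gyg≈ε) → lift (trans (sym (conj-cancelˡ g y))
                                  (trans (conj-congʳ (g ⁻¹) gyg≈ε) (conj-ε (g ⁻¹)))))

  -- Every element normalizes every Z k; the successor case rests on
  -- conjugation commuting with commutators.
  mutual
    Z-NormAll : ∀ k g → NormAll Whole Whole k g
    Z-NormAll zero    = Z₀-normal
    Z-NormAll (suc k) g = Z-NormAll k g , Z-suc-normal k g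

    Z-suc-normal : ∀ k g → Normalizes (Z (suc k)) g
    Z-suc-normal k g y =
      Z-suc-conj k g y ,
      λ gyg∈Z → Z-resp (suc k) (conj-cancelˡ g y) (Z-suc-conj k (g ⁻¹) _ gyg∈Z)

    Z-suc-conj : ∀ k g y → Z (suc k) y → Z (suc k) (conj g y)
    Z-suc-conj k g y (_ , _ , comm∈Z) = tt , Z-NormAll k (conj g y) , λ p _ →
      Z-resp k (conj-commutator-at p)
        (proj₁ (NormAll-at k ≤-refl (Z-NormAll k g) _) (comm∈Z (conj (g ⁻¹) p) tt))
      where
      conj-commutator-at : ∀ p → conj g [ y , conj (g ⁻¹) p ] ≈ [ conj g y , p ]
      conj-commutator-at p =
        trans (conj-commutator g y _) (commutator-congʳ (conj g y) (conj-cancelʳ g p))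

  Z-normal : ∀ k g → Normalizes (Z k) g
  Z-normal k g = NormAll-at k ≤-refl (Z-NormAll k g)

module Restriction {c ℓ : Level} (C : Group c ℓ) (A B : Pred (Group.Carrier C) ℓ)
    (B-sub : GroupDefs.IsSubgroup C B) (A⊆B : A ⊆ B) (n : ℕ)
    (D-normal : ∀ k → k < n → ∀ g →
                GroupDefs.Normalizes C (GroupDefs.Cent C (GroupDefs.Whole C) A k) g)
    where
  open Group C
  open GroupDefs C using (IsSubgroup; Whole; Cent; [_,_])
  open IsSubgroup B-sub
  open Centralizers C

  D E : ℕ → Pred Carrier (c ⊔ ℓ)
  D = Cent Whole A
  E = Cent B A

  commutator-closed : ∀ {x p} → B x → B p → B [ x , p ]
  commutator-closed x∈B p∈B =
    ∙-closed (∙-closed (∙-closed (⁻¹-closed x∈B) (⁻¹-closed p∈B)) x∈B) p∈B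

  E₀ : E zero ≐ D zero ∩ B
  E₀ = (λ (lift x≈ε) → lift x≈ε , resp (sym x≈ε) ε∈) , proj₁

  E-suc : ∀ k → k < n → (∀ {i} → i ≤ k → E i ≐ D i ∩ B) → E (suc k) ≐ D (suc k) ∩ B
  E-suc k k<n IH = E⊆D∩B , D∩B⊆E
    where
    E⊆D∩B : E (suc k) ⊆ D (suc k) ∩ B
    E⊆D∩B (x∈B , _ , comm∈E) =
      (tt , NormAll-intro k (λ i≤k → D-normal _ (≤-<-trans i≤k k<n) _) ,
       λ p p∈A → proj₁ (proj₁ (IH ≤-refl) (comm∈E p p∈A))) , x∈B

    D∩B⊆E : D (suc k) ∩ B ⊆ E (suc k)
    D∩B⊆E ((_ , na , comm∈D) , x∈B) =
      x∈B ,
      NormAll-intro k (λ i≤k →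
        Normalizes-≐ (IH i≤k) (Normalizes-∩ B-sub (NormAll-at k i≤k na) x∈B)) ,
      λ p p∈A → proj₂ (IH ≤-refl) (comm∈D p p∈A , commutator-closed x∈B (A⊆B p∈A))

  restriction : ∀ k → k ≤ n → E k ≐ D k ∩ B
  restriction = <-rec (λ k → k ≤ n → E k ≐ D k ∩ B) λ
    { zero    _   _     → E₀
    ; (suc k) rec 1+k≤n →
        E-suc k 1+k≤n (λ i≤k → rec (s≤s i≤k) (≤-trans (m≤n⇒m≤1+n i≤k) 1+k≤n))
    }

open GroupDefs using (IsSubgroup; Whole; Cent)

-- Lemma 2.5.
lemma2p5 : {c ℓ : Level} (C : Group c ℓ) (A B : Pred (Group.Carrier C) ℓ) →
    IsSubgroup C A → IsSubgroup C B → A ⊆ B →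
    (n : ℕ) → 1 ≤ n →
    (∀ k → k < n → Cent C (Whole C) A k ≐ Cent C (Whole C) (Whole C) k) →
    ∀ j → 1 ≤ j → j ≤ n →
    Cent C B A j ≐ (Cent C (Whole C) A j ∩ B)
lemma2p5 C A B _ B-sub A⊆B n _ D≐Z j _ j≤n = restriction j j≤n
  where
  open Centralizers C using (Normalizes-≐)
  open UpperCentralSeries C using (Z-normal)
  open Restriction C A B B-sub A⊆B n (λ k k<n g → Normalizes-≐ (D≐Z k k<n) (Z-normal k g))
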